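{- Let $\mathbf{n}=(n_1,\dots,n_k)\in\mathbb{Z}_{>0}^k$ with $n_1\ge\dots\ge n_k$. If $\mathbf{m}\in\mathcal{P}(\mathbf{n})\cap\mathbb{Z}_{\ge0}^k$, then $m_1\ge m_2\ge\dots\ge m_k$.
   Context: The lonely runner polyhedron is $$\mathcal{P}(\mathbf{n}):=\left\{\mathbf{x}\in\mathbb{R}^k:\ \frac{n_i-kn_j}{k+1}\le n_jx_i-n_ix_j\le\frac{kn_i-n_j}{k+1}\ \text{for } 1\le i<j\le k\right\}.$$ -}

module Defs where

open import Data.Nat using (ℕ; suc)
open import Data.Fin using (Fin; _<_)
import Data.Integer as ℤ
open import Data.Integer using (ℤ; +_)
open import Data.Rational using (ℚ; _/_; _≤_; _*_; _-_; _+_)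
open import Data.Product using (_×_)

ι : ℕ → ℚ
ι m = (+ m) / 1

InP : (k : ℕ) → (Fin k → ℕ) → (Fin k → ℚ) → Set
InP k n x = ∀ (i j : Fin k) → i < j →
  ((((+ n i) ℤ.- (+ k) ℤ.* (+ n j)) / suc k) ≤ (ι (n j) * x i - ι (n i) * x j))
  × ((ι (n j) * x i - ι (n i) * x j) ≤ (((+ k) ℤ.* (+ n i) ℤ.- (+ n j)) / suc k))

module Submission where

-- Clearing the denominator k + 1 turns the lower inequality of P(n) for a pair
-- i < j into  nᵢ + (k+1) nᵢ mⱼ ≤ k nⱼ + (k+1) nⱼ mᵢ  over ℕ.  If mᵢ < mⱼ, then
-- nⱼ ≤ nᵢ and nᵢ > 0 make the left side at least (k+2) nᵢ + (k+1) nᵢ mᵢ, which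
-- exceeds the right side, at most k nᵢ + (k+1) nᵢ mᵢ.

open import Defs
open import Data.Nat as ℕ using (ℕ; suc; _+_; _*_; _≤_; _>_)
import Data.Nat.Properties as ℕ
import Data.Nat.Tactic.RingSolver as ℕ-Solver
open import Data.Fin using (Fin; _<_)
open import Data.Product using (proj₁)
open import Data.Integer as ℤ using (+_)
import Data.Integer.Properties as ℤ
import Data.Integer.Tactic.RingSolver as ℤ-Solver
open import Data.Integer.GCD using (gcd)
open import Data.Rational as ℚ using (_/_; ↥_; ↧_; toℚᵘ)
open import Data.Rational.Properties
  using (↥-/; ↧-/; ↥ᵘ-toℚᵘ; ↧ᵘ-toℚᵘ; toℚᵘ-mono-≤; toℚᵘ-injective;
         toℚᵘ-homo-+; toℚᵘ-homo‿-; toℚᵘ-homo-*)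
open import Data.Rational.Unnormalised as ℚᵘ using (*≡*)
  renaming (_/_ to _/ᵘ_; _≃_ to _≃ᵘ_)
import Data.Rational.Unnormalised.Properties as ℚᵘ
open import Algebra.Properties.CommutativeSemigroup ℤ.*-commutativeSemigroup
  using (x∙yz≈xz∙y)
open import Relation.Binary.PropositionalEquality

toℚᵘ-/ : ∀ i n → toℚᵘ (i / suc n) ≃ᵘ i /ᵘ suc n
toℚᵘ-/ i n = *≡* (begin
  ℚᵘ.↥ toℚᵘ q ℤ.* + suc n  ≡⟨ cong₂ ℤ._*_ (↥ᵘ-toℚᵘ q) (sym (↧-/ i (suc n))) ⟩
  ↥ q ℤ.* (↧ q ℤ.* g)      ≡⟨ x∙yz≈xz∙y (↥ q) (↧ q) g ⟩
  (↥ q ℤ.* g) ℤ.* ↧ q      ≡⟨ cong₂ ℤ._*_ (↥-/ i (suc n)) (sym (↧ᵘ-toℚᵘ q)) ⟩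
  i ℤ.* ℚᵘ.↧ toℚᵘ q        ∎)
  where
  open ≡-Reasoning
  q = i / suc n
  g = gcd i (+ suc n)

/-≤-/⇒*≤* : ∀ i j m n → i / suc m ℚ.≤ j / suc n → i ℤ.* + suc n ℤ.≤ j ℤ.* + suc m
/-≤-/⇒*≤* i j m n i/m≤j/n = ℚᵘ.drop-*≤* (begin
  i /ᵘ suc m        ≃⟨ toℚᵘ-/ i m ⟨
  toℚᵘ (i / suc m)  ≤⟨ toℚᵘ-mono-≤ i/m≤j/n ⟩
  toℚᵘ (j / suc n)  ≃⟨ toℚᵘ-/ j n ⟩
  j /ᵘ suc n        ∎)
  where open ℚᵘ.≤-Reasoning

ι-homo-* : ∀ a b → ι a ℚ.* ι b ≡ ι (a * b)
ι-homo-* a b = toℚᵘ-injective (begin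
  toℚᵘ (ι a ℚ.* ι b)          ≈⟨ toℚᵘ-homo-* (ι a) (ι b) ⟩
  toℚᵘ (ι a) ℚᵘ.* toℚᵘ (ι b)  ≈⟨ ℚᵘ.*-cong (toℚᵘ-/ (+ a) 0) (toℚᵘ-/ (+ b) 0) ⟩
  (+ a ℤ.* + b) /ᵘ 1          ≡⟨ cong (_/ᵘ 1) (ℤ.pos-* a b) ⟨
  + (a * b) /ᵘ 1              ≈⟨ toℚᵘ-/ (+ (a * b)) 0 ⟨
  toℚᵘ (ι (a * b))            ∎)
  where open ℚᵘ.≃-Reasoning

ι-‿ι : ∀ a b → ι a ℚ.- ι b ≡ (+ a ℤ.- + b) / 1
ι-‿ι a b = toℚᵘ-injective (begin
  toℚᵘ (ι a ℚ.- ι b)                  ≈⟨ toℚᵘ-homo-+ (ι a) (ℚ.- ι b) ⟩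
  toℚᵘ (ι a) ℚᵘ.+ toℚᵘ (ℚ.- ι b)      ≈⟨ ℚᵘ.+-cong (toℚᵘ-/ (+ a) 0) toℚᵘ-[-ιb] ⟩
  (+ a /ᵘ 1) ℚᵘ.- (+ b /ᵘ 1)          ≈⟨ *≡* (cong (ℤ._* + 1) a*1-b*1≡a-b) ⟩
  (+ a ℤ.- + b) /ᵘ 1                  ≈⟨ toℚᵘ-/ (+ a ℤ.- + b) 0 ⟨
  toℚᵘ ((+ a ℤ.- + b) / 1)            ∎)
  where
  open ℚᵘ.≃-Reasoning
  toℚᵘ-[-ιb] : toℚᵘ (ℚ.- ι b) ≃ᵘ ℚᵘ.- (+ b /ᵘ 1)
  toℚᵘ-[-ιb] = ℚᵘ.≃-trans (toℚᵘ-homo‿- (ι b)) (ℚᵘ.-‿cong (toℚᵘ-/ (+ b) 0))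
  a*1-b*1≡a-b : + a ℤ.* + 1 ℤ.+ ℤ.- + b ℤ.* + 1 ≡ + a ℤ.- + b
  a*1-b*1≡a-b = cong₂ ℤ._+_ (ℤ.*-identityʳ (+ a)) (ℤ.*-identityʳ (ℤ.- + b))

-- Adding b s + d t to both sides leaves an inequality between natural numbers.
[a-b]*s≤[c-d]*t⇒a*s+d*t≤c*t+b*s : ∀ a b c d s t →
  (+ a ℤ.- + b) ℤ.* + s ℤ.≤ (+ c ℤ.- + d) ℤ.* + t → a * s + d * t ≤ c * t + b * s
[a-b]*s≤[c-d]*t⇒a*s+d*t≤c*t+b*s a b c d s t h = ℤ.drop‿+≤+ (begin
  + (a * s + d * t)                                         ≡⟨ pos-*+* a s d t ⟩
  + a ℤ.* + s ℤ.+ + d ℤ.* + t                               ≡⟨ shiftˡ (+ a) (+ b) (+ d) (+ s) (+ t) ⟩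
  (+ a ℤ.- + b) ℤ.* + s ℤ.+ (+ b ℤ.* + s ℤ.+ + d ℤ.* + t)  ≤⟨ ℤ.+-monoˡ-≤ _ h ⟩
  (+ c ℤ.- + d) ℤ.* + t ℤ.+ (+ b ℤ.* + s ℤ.+ + d ℤ.* + t)  ≡⟨ shiftʳ (+ b) (+ c) (+ d) (+ s) (+ t) ⟨
  + c ℤ.* + t ℤ.+ + b ℤ.* + s                               ≡⟨ pos-*+* c t b s ⟨
  + (c * t + b * s)                                         ∎)
  where
  open ℤ.≤-Reasoning
  pos-*+* : ∀ x y z w → + (x * y + z * w) ≡ + x ℤ.* + y ℤ.+ + z ℤ.* + w
  pos-*+* x y z w = trans (ℤ.pos-+ (x * y) (z * w)) (cong₂ ℤ._+_ (ℤ.pos-* x y) (ℤ.pos-* z w))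
  shiftˡ : ∀ a b d s t →
    a ℤ.* s ℤ.+ d ℤ.* t ≡ (a ℤ.- b) ℤ.* s ℤ.+ (b ℤ.* s ℤ.+ d ℤ.* t)
  shiftˡ = ℤ-Solver.solve-∀
  shiftʳ : ∀ b c d s t →
    c ℤ.* t ℤ.+ b ℤ.* s ≡ (c ℤ.- d) ℤ.* t ℤ.+ (b ℤ.* s ℤ.+ d ℤ.* t)
  shiftʳ = ℤ-Solver.solve-∀

lowerBound⇒ℕ : ∀ k {nᵢ nⱼ mᵢ mⱼ} →
  (+ nᵢ ℤ.- + k ℤ.* + nⱼ) / suc k ℚ.≤ ι nⱼ ℚ.* ι mᵢ ℚ.- ι nᵢ ℚ.* ι mⱼ →
  nᵢ + nᵢ * mⱼ * suc k ≤ nⱼ * mᵢ * suc k + k * nⱼ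
lowerBound⇒ℕ k {nᵢ} {nⱼ} {mᵢ} {mⱼ} lower =
  subst₂ _≤_ (cong₂ _+_ (ℕ.*-identityʳ nᵢ) refl)
             (cong₂ _+_ refl (ℕ.*-identityʳ (k * nⱼ)))
    ([a-b]*s≤[c-d]*t⇒a*s+d*t≤c*t+b*s nᵢ (k * nⱼ) (nⱼ * mᵢ) (nᵢ * mⱼ) 1 (suc k)
      (/-≤-/⇒*≤* (+ nᵢ ℤ.- + (k * nⱼ)) (+ (nⱼ * mᵢ) ℤ.- + (nᵢ * mⱼ)) k 0
        (subst₂ ℚ._≤_ lhs rhs lower)))
  where
  lhs : (+ nᵢ ℤ.- + k ℤ.* + nⱼ) / suc k ≡ (+ nᵢ ℤ.- + (k * nⱼ)) / suc k
  lhs = cong (λ z → (+ nᵢ ℤ.- z) / suc k) (sym (ℤ.pos-* k nⱼ))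
  rhs : ι nⱼ ℚ.* ι mᵢ ℚ.- ι nᵢ ℚ.* ι mⱼ ≡ (+ (nⱼ * mᵢ) ℤ.- + (nᵢ * mⱼ)) / 1
  rhs = trans (cong₂ ℚ._-_ (ι-homo-* nⱼ mᵢ) (ι-homo-* nᵢ mⱼ)) (ι-‿ι (nⱼ * mᵢ) (nᵢ * mⱼ))

ascent-violates-lowerBound : ∀ k {a b x y} → a > 0 → b ≤ a → x ℕ.< y →
  b * x * suc k + k * b ℕ.< a + a * y * suc k
ascent-violates-lowerBound k {a} {b} {x} {y} a>0 b≤a x<y = begin-strict
  b * x * suc k + k * b          ≤⟨ ℕ.+-mono-≤ (ℕ.*-monoˡ-≤ (suc k) (ℕ.*-monoˡ-≤ x b≤a)) (ℕ.*-monoʳ-≤ k b≤a) ⟩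
  a * x * suc k + k * a          <⟨ ℕ.m<m+n _ (ℕ.+-mono-< a>0 a>0) ⟩
  a * x * suc k + k * a + (a + a) ≡⟨ regroup a x k ⟩
  a + a * suc x * suc k          ≤⟨ ℕ.+-monoʳ-≤ a (ℕ.*-monoˡ-≤ (suc k) (ℕ.*-monoʳ-≤ a x<y)) ⟩
  a + a * y * suc k              ∎
  where
  open ℕ.≤-Reasoning
  regroup : ∀ a x k → a * x * suc k + k * a + (a + a) ≡ a + a * suc x * suc k
  regroup = ℕ-Solver.solve-∀

proposition3 : (k : ℕ) (n : Fin k → ℕ) →
    (∀ i → n i > 0) →
    (∀ (i j : Fin k) → i < j → n j ≤ n i) →
    (m : Fin k → ℕ) →
    InP k n (λ i → ι (m i)) →
    ∀ (i j : Fin k) → i < j → m j ≤ m i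
proposition3 k n pos mono m m∈P i j i<j = ℕ.≮⇒≥ λ mᵢ<mⱼ →
  ℕ.<⇒≱ (ascent-violates-lowerBound k (pos i) (mono i j i<j) mᵢ<mⱼ)
        (lowerBound⇒ℕ k (proj₁ (m∈P i j i<j)))
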